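{- Let $m,n,p$ be positive integers with $p\ge 2$, and let $A$ be an $(mp+1)\times np$ array of nonnegative integers. Let $a$ be the first entry and $b_1,\dots,b_{p-1}$ the last $p-1$ entries (in order) of the top row of $A$, and let $c$ be the first entry and $d_1,\dots,d_{p-1}$ the last $p-1$ entries (in order) of the bottom row of $A$. Suppose that all $p\times p$ subarrays of $A$ formed from $p$ consecutive rows and $p$ consecutive columns have the same sum. Then $a+\sum_{i=1}^{p-1}b_i=c+\sum_{i=1}^{p-1}d_i$. -}

module Defs where

open import Data.Nat using (ℕ; zero; suc; _+_; _<_; _<?_)
open import Data.Fin using (Fin; fromℕ<)
open import Relation.Nullary using (yes; no)

sumTo : ℕ → (ℕ → ℕ) → ℕ
sumTo zero    f = 0
sumTo (suc k) f = sumTo k f + f k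

Array : ℕ → ℕ → Set
Array R C = Fin R → Fin C → ℕ

-- entry (i , j) of A, read at natural-number indices; 0 outside the array
-- (only ever used at in-range indices below)
entry : ∀ {R C} → Array R C → ℕ → ℕ → ℕ
entry {R} {C} A i j with i <? R | j <? C
... | yes i<R | yes j<C = A (fromℕ< i<R) (fromℕ< j<C)
... | _       | _       = 0

blockSum : ∀ {R C} → Array R C → ℕ → ℕ → ℕ → ℕ
blockSum A p r s = sumTo p (λ i → sumTo p (λ j → entry A (r + i) (s + j)))

-- Sliding a p×p block down by one row removes row r and adds row r + p, so equal block
-- sums make every p-window sum of row r equal to the one in row r + p; as m p is a
-- multiple of p, the top and bottom rows then have equal p-window sums everywhere.
-- Tiling by windows, the two rows have equal total sums and equal sums over the columns
-- 1, …, (n − 1) p; what is left over is the first entry together with the last p − 1.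
module Submission where

open import Defs
open import Data.Nat using (ℕ; zero; suc; _+_; _*_; _∸_; _≤_; _≥_; s≤s; z≤n)
open import Data.Nat.Properties
open import Relation.Binary.PropositionalEquality
open ≡-Reasoning

sumTo-cong : ∀ k {f g : ℕ → ℕ} → (∀ i → f i ≡ g i) → sumTo k f ≡ sumTo k g
sumTo-cong zero    f≗g = refl
sumTo-cong (suc k) f≗g = cong₂ _+_ (sumTo-cong k f≗g) (f≗g k)

sumTo-+ : ∀ a b (g : ℕ → ℕ) → sumTo (a + b) g ≡ sumTo a g + sumTo b (λ j → g (a + j))
sumTo-+ a zero    g = trans (cong (λ x → sumTo x g) (+-identityʳ a)) (sym (+-identityʳ _))
sumTo-+ a (suc b) g = begin
  sumTo (a + suc b) g                                ≡⟨ cong (λ x → sumTo x g) (+-suc a b) ⟩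
  sumTo (a + b) g + g (a + b)                        ≡⟨ cong (_+ g (a + b)) (sumTo-+ a b g) ⟩
  sumTo a g + sumTo b (λ j → g (a + j)) + g (a + b)  ≡⟨ +-assoc (sumTo a g) _ _ ⟩
  sumTo a g + sumTo (suc b) (λ j → g (a + j))        ∎

sumTo-suc : ∀ k (g : ℕ → ℕ) → sumTo (suc k) g ≡ g 0 + sumTo k (λ i → g (suc i))
sumTo-suc zero    g = +-comm 0 (g 0)
sumTo-suc (suc k) g = trans (cong (_+ g (suc k)) (sumTo-suc k g)) (+-assoc (g 0) _ _)

window : ℕ → (ℕ → ℕ) → ℕ → ℕ
window p g s = sumTo p (λ i → g (s + i))

window-suc : ∀ q (g : ℕ → ℕ) s → window (suc q) g s ≡ g s + window q g (suc s)
window-suc q g s = begin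
  window (suc q) g s                        ≡⟨ sumTo-suc q (λ i → g (s + i)) ⟩
  g (s + 0) + sumTo q (λ i → g (s + suc i)) ≡⟨ cong₂ _+_ (cong g (+-identityʳ s))
                                                        (sumTo-cong q (λ i → cong g (+-suc s i))) ⟩
  g s + window q g (suc s)                  ∎

window-slide : ∀ q (g : ℕ → ℕ) s →
  window (suc q) g s ≡ window (suc q) g (suc s) → g s ≡ g (s + suc q)
window-slide q g s eq = +-cancelˡ-≡ (window q g (suc s)) _ _ (begin
  window q g (suc s) + g s           ≡⟨ +-comm _ (g s) ⟩
  g s + window q g (suc s)           ≡⟨ sym (window-suc q g s) ⟩
  window (suc q) g s                 ≡⟨ eq ⟩
  window q g (suc s) + g (suc s + q) ≡⟨ cong (λ x → window q g (suc s) + g x) (sym (+-suc s q)) ⟩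
  window q g (suc s) + g (s + suc q) ∎)

periodic⇒multiple : ∀ p L (g : ℕ → ℕ) → (∀ r → r + p ≤ L → g r ≡ g (r + p)) →
  ∀ k → k * p ≤ L → g 0 ≡ g (k * p)
periodic⇒multiple p L g period zero    _   = refl
periodic⇒multiple p L g period (suc k) kp≤L = begin
  g 0           ≡⟨ periodic⇒multiple p L g period k (≤-trans (m≤n+m (k * p) p) kp≤L) ⟩
  g (k * p)     ≡⟨ period (k * p) (subst (_≤ L) (+-comm p (k * p)) kp≤L) ⟩
  g (k * p + p) ≡⟨ cong g (+-comm (k * p) p) ⟩
  g (p + k * p) ∎

window-tiling : ∀ p L (g g′ : ℕ → ℕ) → (∀ s → s + p ≤ L → window p g s ≡ window p g′ s) →
  ∀ k s → s + k * p ≤ L → window (k * p) g s ≡ window (k * p) g′ s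
window-tiling p L g g′ windows zero    s _ = refl
window-tiling p L g g′ windows (suc k) s bound = begin
  window (p + k * p) g s                         ≡⟨ sumTo-+ p (k * p) _ ⟩
  window p g s + sumTo (k * p) (λ j → g (s + (p + j)))
    ≡⟨ cong₂ _+_ (windows s (≤-trans (+-monoʳ-≤ s (m≤m+n p (k * p))) bound)) (begin
         sumTo (k * p) (λ j → g (s + (p + j)))   ≡⟨ sumTo-cong (k * p) (λ j → cong g (sym (+-assoc s p j))) ⟩
         window (k * p) g (s + p)                ≡⟨ window-tiling p L g g′ windows k (s + p)
                                                      (subst (_≤ L) (sym (+-assoc s p (k * p))) bound) ⟩
         window (k * p) g′ (s + p)               ≡⟨ sumTo-cong (k * p) (λ j → cong g′ (+-assoc s p j)) ⟩
         sumTo (k * p) (λ j → g′ (s + (p + j)))  ∎) ⟩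
  window p g′ s + sumTo (k * p) (λ j → g′ (s + (p + j))) ≡⟨ sym (sumTo-+ p (k * p) _) ⟩
  window (p + k * p) g′ s                        ∎

sumTo-ends+middle : ∀ b a (g : ℕ → ℕ) →
  sumTo (suc (b + a)) g ≡ (g 0 + window b g (suc a)) + window a g 1
sumTo-ends+middle b a g = begin
  sumTo (suc (b + a)) g                       ≡⟨ sumTo-suc (b + a) g ⟩
  g 0 + sumTo (b + a) (λ i → g (suc i))       ≡⟨ cong (λ x → g 0 + sumTo x (λ i → g (suc i))) (+-comm b a) ⟩
  g 0 + sumTo (a + b) (λ i → g (suc i))       ≡⟨ cong (g 0 +_) (sumTo-+ a b (λ i → g (suc i))) ⟩
  g 0 + (window a g 1 + window b g (suc a))   ≡⟨ cong (g 0 +_) (+-comm (window a g 1) _) ⟩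
  g 0 + (window b g (suc a) + window a g 1)   ≡⟨ sym (+-assoc (g 0) _ _) ⟩
  (g 0 + window b g (suc a)) + window a g 1   ∎

first+last-agree : ∀ q n (g g′ : ℕ → ℕ) →
  (∀ s → s + suc q ≤ suc n * suc q → window (suc q) g s ≡ window (suc q) g′ s) →
  g 0 + window q g (suc n * suc q ∸ q) ≡ g′ 0 + window q g′ (suc n * suc q ∸ q)
first+last-agree q n g g′ windows = begin
  g 0 + window q g (L ∸ q)       ≡⟨ cong (λ s → g 0 + window q g s) tail-start ⟩
  ends g                         ≡⟨ +-cancelʳ-≡ (window np g 1) _ _ totals ⟩
  ends g′                        ≡⟨ cong (λ s → g′ 0 + window q g′ s) (sym tail-start) ⟩
  g′ 0 + window q g′ (L ∸ q)     ∎
  where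
    p = suc q
    np = n * p
    L = suc n * p

    tail-start : L ∸ q ≡ suc np
    tail-start = trans (cong (_∸ q) (sym (+-suc q np))) (m+n∸m≡n q (suc np))

    ends : (ℕ → ℕ) → ℕ
    ends h = h 0 + window q h (suc np)

    middle : window np g 1 ≡ window np g′ 1
    middle = window-tiling p L g g′ windows n 1 (subst (suc np ≤_) (+-suc q np) (m≤n+m (suc np) q))

    totals : ends g + window np g 1 ≡ ends g′ + window np g 1
    totals = begin
      ends g + window np g 1        ≡⟨ sym (sumTo-ends+middle q np g) ⟩
      window L g 0                  ≡⟨ window-tiling p L g g′ windows (suc n) 0 ≤-refl ⟩
      window L g′ 0                 ≡⟨ sumTo-ends+middle q np g′ ⟩
      ends g′ + window np g′ 1      ≡⟨ cong (ends g′ +_) (sym middle) ⟩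
      ends g′ + window np g 1       ∎

lemma4p1 : (m n p : ℕ) → m ≥ 1 → n ≥ 1 → p ≥ 2 →
    (A : Array (m * p + 1) (n * p)) →
    (∀ r s r′ s′ → r + p ≤ m * p + 1 → s + p ≤ n * p →
      r′ + p ≤ m * p + 1 → s′ + p ≤ n * p →
      blockSum A p r s ≡ blockSum A p r′ s′) →
    entry A 0 0 + sumTo (p ∸ 1) (λ i → entry A 0 (n * p ∸ (p ∸ 1) + i))
      ≡ entry A (m * p) 0 + sumTo (p ∸ 1) (λ i → entry A (m * p) (n * p ∸ (p ∸ 1) + i))
lemma4p1 m (suc n) (suc q) _ (s≤s z≤n) (s≤s _) A blocks-equal =
  first+last-agree q n (entry A 0) (entry A (m * p)) top-windows≡bottom-windows
  where
    p = suc q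

    rowWindow : ℕ → ℕ → ℕ
    rowWindow s r = window p (entry A r) s

    rowWindow-periodic : ∀ s → s + p ≤ suc n * p →
      ∀ r → r + p ≤ m * p → rowWindow s r ≡ rowWindow s (r + p)
    rowWindow-periodic s s-fits r r-fits = window-slide q (rowWindow s) r
      (blocks-equal r s (suc r) s (≤-trans r-fits (m≤m+n (m * p) 1)) s-fits
        (subst (suc (r + p) ≤_) (+-comm 1 (m * p)) (s≤s r-fits)) s-fits)

    top-windows≡bottom-windows : ∀ s → s + p ≤ suc n * p → rowWindow s 0 ≡ rowWindow s (m * p)
    top-windows≡bottom-windows s s-fits =
      periodic⇒multiple p (m * p) (rowWindow s) (rowWindow-periodic s s-fits) m ≤-refl
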